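{- Let $X=\{a,b,c,d\}$ (four distinct elements) with the quandle operation $\lhd$ given by $a\lhd a=a,\ a\lhd b=d,\ a\lhd c=b,\ a\lhd d=c$; $b\lhd a=c,\ b\lhd b=b,\ b\lhd c=d,\ b\lhd d=a$; $c\lhd a=d,\ c\lhd b=a,\ c\lhd c=c,\ c\lhd d=b$; $d\lhd a=b,\ d\lhd b=c,\ d\lhd c=a,\ d\lhd d=d$. Then the only topologies on $X$ compatible with this quandle structure are the discrete topology and the coarse (indiscrete) topology.
   Context: A topology $\mathcal{T}$ on a quandle $(Q,\lhd)$ is called compatible ($Q$-compatible) if the map $Q\times Q\to Q$, $(x,y)\mapsto x\lhd y$, is continuous (product topology) and for every $y\in Q$ the map $x\mapsto x\lhd y$ is a homeomorphism of $(Q,\mathcal{T})$. -}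

module Defs where

open import Data.Nat using (ℕ)
open import Data.Bool using (Bool; true; false)
open import Data.Fin using (Fin; zero; suc)
open import Data.Fin.Subset using (Subset; _∈_; ⊥; ⊤; _∩_)
open import Data.Vec using (tabulate; lookup)
open import Data.Product using (Σ; _×_; ∃; _,_)
open import Data.Sum using (_⊎_)
open import Relation.Binary.PropositionalEquality using (_≡_)
open import Function.Bundles using (_⇔_)

Family : ℕ → Set
Family n = Subset n → Bool

Open : {n : ℕ} → Family n → Subset n → Set
Open T S = T S ≡ true

record IsTopology {n : ℕ} (T : Family n) : Set₁ where
  field
    empty-open : Open T ⊥
    full-open  : Open T ⊤
    inter-open : ∀ U V → Open T U → Open T V → Open T (U ∩ V)
    union-open : {I : Set} (U : I → Subset n) → (∀ i → Open T (U i)) →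
                 ∀ S → (∀ x → (x ∈ S) ⇔ (∃ λ i → x ∈ U i)) → Open T S

preimage : {n : ℕ} → (Fin n → Fin n) → Subset n → Subset n
preimage g O = tabulate (λ x → lookup O (g x))

Continuous : {n : ℕ} → Family n → (Fin n → Fin n) → Set
Continuous T g = ∀ O → Open T O → Open T (preimage g O)

ProdOpen : {n : ℕ} → Family n → (Fin n → Fin n → Set) → Set
ProdOpen T W = ∀ x y → W x y →
  Σ (Subset _) λ U → Σ (Subset _) λ V →
    Open T U × Open T V × x ∈ U × y ∈ V ×
    (∀ x′ y′ → x′ ∈ U → y′ ∈ V → W x′ y′)

Continuous₂ : {n : ℕ} → Family n → (Fin n → Fin n → Fin n) → Set
Continuous₂ T op = ∀ O → Open T O → ProdOpen T (λ x y → op x y ∈ O)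

IsHomeomorphism : {n : ℕ} → Family n → (Fin n → Fin n) → Set
IsHomeomorphism T f = Σ (Fin _ → Fin _) λ g →
  (∀ x → g (f x) ≡ x) × (∀ x → f (g x) ≡ x) × Continuous T f × Continuous T g

Compatible : {n : ℕ} → (Fin n → Fin n → Fin n) → Family n → Set₁
Compatible op T = IsTopology T × Continuous₂ T op ×
  (∀ y → IsHomeomorphism T (λ x → op x y))

Discrete : {n : ℕ} → Family n → Set
Discrete T = ∀ S → Open T S

Indiscrete : {n : ℕ} → Family n → Set
Indiscrete T = ∀ S → Open T S ⇔ (S ≡ ⊥ ⊎ S ≡ ⊤)

a b c d : Fin 4
a = zero
b = suc zero
c = suc (suc zero)
d = suc (suc (suc zero))

_◃_ : Fin 4 → Fin 4 → Fin 4
zero ◃ zero = a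
zero ◃ suc zero = d
zero ◃ suc (suc zero) = b
zero ◃ suc (suc (suc zero)) = c
suc zero ◃ zero = c
suc zero ◃ suc zero = b
suc zero ◃ suc (suc zero) = d
suc zero ◃ suc (suc (suc zero)) = a
suc (suc zero) ◃ zero = d
suc (suc zero) ◃ suc zero = a
suc (suc zero) ◃ suc (suc zero) = c
suc (suc zero) ◃ suc (suc (suc zero)) = b
suc (suc (suc zero)) ◃ zero = b
suc (suc (suc zero)) ◃ suc zero = c
suc (suc (suc zero)) ◃ suc (suc zero) = a
suc (suc (suc zero)) ◃ suc (suc (suc zero)) = d

-- Every map is continuous for the discrete and for the indiscrete topology, so
-- both are compatible. Conversely, let T be compatible. The right translations
-- act transitively on X, so one open singleton makes every singleton open and T
-- discrete. Otherwise let S be a nonempty proper open set with least element x.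
-- As x ◃ x = x and – ◃ x permutes the other three points cyclically, the open set
-- S ∩ (– ◃ x)⁻¹ S still contains x but has lost a point of S; repeating this
-- yields an open singleton, which is impossible, so T is indiscrete.
module Submission where

open import Defs
open import Data.Bool using (true)
open import Data.Bool.Properties using (_≟_)
open import Data.Empty using (⊥-elim)
open import Data.Fin using (Fin; zero; suc)
import Data.Fin.Properties as Fin
open import Data.Fin.Subset using (Subset; Side; inside; outside; ⁅_⁆; _∈_; _⊆_; _∩_)
  renaming (⊥ to ∅; ⊤ to Full)
open import Data.Fin.Subset.Properties
  using (∩-zeroˡ; ∩-zeroʳ; ∩-idem; x∈⁅x⁆; x∈⁅y⁆⇒x≡y; ∉⊥; ∈⊤; ⊆⊤; ⊆-antisym; Empty-unique; nonempty?)
open import Data.Nat using (ℕ)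
open import Data.Product using (Σ; ∃; _×_; _,_; proj₁)
open import Data.Sum using (_⊎_; inj₁; inj₂)
open import Data.Vec using ([]; _∷_; replicate)
open import Data.Vec.Properties using (tabulate-cong; tabulate∘lookup; lookup-replicate)
open import Function.Bundles using (_⇔_; mk⇔; Equivalence)
open import Relation.Binary.PropositionalEquality using (_≡_; refl; sym; trans; subst; subst₂)
open import Relation.Nullary using (yes; no)
open import Relation.Nullary.Decidable using (from-yes)

private
  variable
    n : ℕ

RightInvertible : (Fin n → Fin n → Fin n) → Set
RightInvertible op = ∀ y → Σ (Fin _ → Fin _) λ g →
  (∀ x → g (op x y) ≡ x) × (∀ x → op (g x) y ≡ x)

preimage-replicate : (g : Fin n → Fin n) (s : Side) →
  preimage g (replicate n s) ≡ replicate n s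
preimage-replicate g s = trans
  (tabulate-cong λ x → trans (lookup-replicate (g x) s) (sym (lookup-replicate x s)))
  (tabulate∘lookup (replicate _ s))

homeomorphism-if-allContinuous : {T : Family n} → (∀ f → Continuous T f) →
  (f g : Fin n → Fin n) → (∀ x → g (f x) ≡ x) → (∀ x → f (g x) ≡ x) →
  IsHomeomorphism T f
homeomorphism-if-allContinuous cont f g gf fg = g , gf , fg , cont f , cont g

compatible-if-allContinuous : {op : Fin n → Fin n → Fin n} {T : Family n} →
  RightInvertible op → IsTopology T → Continuous₂ T op → (∀ f → Continuous T f) →
  Compatible op T
compatible-if-allContinuous {op = op} inv top cont₂ cont = top , cont₂ , λ y →
  let (g , gf , fg) = inv y
  in homeomorphism-if-allContinuous cont (λ x → op x y) g gf fg

module DiscreteTopology {T : Family n} (D : Discrete T) where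

  isTopology : IsTopology T
  isTopology = record
    { empty-open = D _
    ; full-open  = D _
    ; inter-open = λ _ _ _ _ → D _
    ; union-open = λ _ _ _ _ → D _
    }

  continuous₂ : (op : Fin n → Fin n → Fin n) → Continuous₂ T op
  continuous₂ op O _ x y xy∈O = ⁅ x ⁆ , ⁅ y ⁆ , D _ , D _ , x∈⁅x⁆ x , x∈⁅x⁆ y ,
    λ x′ y′ x′∈ y′∈ → subst₂ (λ u v → op u v ∈ O)
      (sym (x∈⁅y⁆⇒x≡y x x′∈)) (sym (x∈⁅y⁆⇒x≡y y y′∈)) xy∈O

  compatible : {op : Fin n → Fin n → Fin n} → RightInvertible op → Compatible op T
  compatible inv = compatible-if-allContinuous inv isTopology (continuous₂ _) (λ _ _ _ → D _)

module IndiscreteTopology {T : Family n} (I : Indiscrete T) where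

  trivial-if-open : ∀ {S} → Open T S → S ≡ ∅ ⊎ S ≡ Full
  trivial-if-open = Equivalence.to (I _)

  ∅-open : Open T ∅
  ∅-open = Equivalence.from (I _) (inj₁ refl)

  Full-open : Open T Full
  Full-open = Equivalence.from (I _) (inj₂ refl)

  ∩-open : ∀ U V → Open T U → Open T V → Open T (U ∩ V)
  ∩-open U V U-open V-open with trivial-if-open U-open | trivial-if-open V-open
  ... | inj₁ refl | _         = subst (Open T) (sym (∩-zeroˡ V)) ∅-open
  ... | inj₂ refl | inj₁ refl = subst (Open T) (sym (∩-zeroʳ Full)) ∅-open
  ... | inj₂ refl | inj₂ refl = subst (Open T) (sym (∩-idem Full)) Full-open

  ⋃-open : {J : Set} (U : J → Subset n) → (∀ i → Open T (U i)) →
           ∀ S → (∀ x → (x ∈ S) ⇔ (∃ λ i → x ∈ U i)) → Open T S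
  ⋃-open U U-open S S-is-⋃U with nonempty? S
  ... | no S-empty = subst (Open T) (sym (Empty-unique S-empty)) ∅-open
  ... | yes (x , x∈S) with Equivalence.to (S-is-⋃U x) x∈S
  ... | i , x∈Ui with trivial-if-open (U-open i)
  ... | inj₁ Ui≡∅    = ⊥-elim (∉⊥ (subst (x ∈_) Ui≡∅ x∈Ui))
  ... | inj₂ Ui≡Full = subst (Open T) (sym (⊆-antisym ⊆⊤ Full⊆S)) Full-open
    where
    Full⊆S : Full ⊆ S
    Full⊆S {z} _ = Equivalence.from (S-is-⋃U z) (i , subst (z ∈_) (sym Ui≡Full) ∈⊤)

  isTopology : IsTopology T
  isTopology = record
    { empty-open = ∅-open
    ; full-open  = Full-open
    ; inter-open = ∩-open
    ; union-open = ⋃-open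
    }

  continuous : (f : Fin n → Fin n) → Continuous T f
  continuous f O O-open with trivial-if-open O-open
  ... | inj₁ refl = subst (Open T) (sym (preimage-replicate f outside)) ∅-open
  ... | inj₂ refl = subst (Open T) (sym (preimage-replicate f inside)) Full-open

  continuous₂ : (op : Fin n → Fin n → Fin n) → Continuous₂ T op
  continuous₂ op O O-open x y xy∈O with trivial-if-open O-open
  ... | inj₁ refl = ⊥-elim (∉⊥ xy∈O)
  ... | inj₂ refl = Full , Full , Full-open , Full-open , ∈⊤ , ∈⊤ , λ _ _ _ _ → ∈⊤

  compatible : {op : Fin n → Fin n → Fin n} → RightInvertible op → Compatible op T
  compatible inv = compatible-if-allContinuous inv isTopology (continuous₂ _) continuous

discrete-if-singletons-open : {T : Family n} → IsTopology T →
  (∀ x → Open T ⁅ x ⁆) → Discrete T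
discrete-if-singletons-open top singleton-open S =
  union-open (λ ((x , _) : Σ (Fin _) (_∈ S)) → ⁅ x ⁆) (λ (x , _) → singleton-open x) S
    λ x → mk⇔ (λ x∈S → (x , x∈S) , x∈⁅x⁆ x)
              (λ ((y , y∈S) , x∈⁅y⁆) → subst (_∈ S) (sym (x∈⁅y⁆⇒x≡y y x∈⁅y⁆)) y∈S)
  where open IsTopology top

indiscrete-if-only-trivial-open : {T : Family n} → IsTopology T →
  (∀ S → Open T S → S ≡ ∅ ⊎ S ≡ Full) → Indiscrete T
indiscrete-if-only-trivial-open top only-trivial S = mk⇔ (only-trivial S) λ where
    (inj₁ refl) → empty-open
    (inj₂ refl) → full-open
  where open IsTopology top

module CompatibleTopology {op : Fin n → Fin n → Fin n} {T : Family n}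
                          (C : Compatible op T) where

  open IsTopology (proj₁ C) public

  translate-open : ∀ y {S} → Open T S → Open T (preimage (λ x → op x y) S)
  translate-open y = let (_ , _ , homeo) = C; (_ , _ , _ , cont , _) = homeo y in cont _

  shrink-open : ∀ y {S} → Open T S → Open T (S ∩ preimage (λ x → op x y) S)
  shrink-open y S-open = inter-open _ _ S-open (translate-open y S-open)

◃-cube : ∀ x y → ((x ◃ y) ◃ y) ◃ y ≡ x
◃-cube = from-yes (Fin.all? λ x → Fin.all? λ y → ((x ◃ y) ◃ y) ◃ y Fin.≟ x)

◃-rightInvertible : RightInvertible _◃_
◃-rightInvertible y = (λ x → (x ◃ y) ◃ y) , (λ x → ◃-cube x y) , (λ x → ◃-cube x y)

module _ {T : Family 4} (C : Compatible _◃_ T) where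

  open CompatibleTopology C

  TrivialOrSingletonOpen : Subset 4 → Set
  TrivialOrSingletonOpen S = S ≡ ∅ ⊎ S ≡ Full ⊎ ∃ λ x → Open T ⁅ x ⁆

  private
    open-singleton : ∀ {S} x → Open T ⁅ x ⁆ → TrivialOrSingletonOpen S
    open-singleton x x-open = inj₂ (inj₂ (x , x-open))

  a-open-if-singleton-open : ∀ x → Open T ⁅ x ⁆ → Open T ⁅ a ⁆
  a-open-if-singleton-open zero                   = λ a-open → a-open
  a-open-if-singleton-open (suc zero)             = translate-open c
  a-open-if-singleton-open (suc (suc zero))       = translate-open d
  a-open-if-singleton-open (suc (suc (suc zero))) = translate-open b

  singletons-open-if-a-open : Open T ⁅ a ⁆ → ∀ x → Open T ⁅ x ⁆
  singletons-open-if-a-open a-open zero                   = a-open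
  singletons-open-if-a-open a-open (suc zero)             = translate-open d a-open
  singletons-open-if-a-open a-open (suc (suc zero))       = translate-open b a-open
  singletons-open-if-a-open a-open (suc (suc (suc zero))) = translate-open c a-open

  trivial-or-singleton-open : ∀ S → Open T S → TrivialOrSingletonOpen S
  trivial-or-singleton-open (outside ∷ outside ∷ outside ∷ outside ∷ []) _ = inj₁ refl
  trivial-or-singleton-open (inside  ∷ inside  ∷ inside  ∷ inside  ∷ []) _ = inj₂ (inj₁ refl)
  trivial-or-singleton-open (inside  ∷ outside ∷ outside ∷ outside ∷ []) p = open-singleton a p
  trivial-or-singleton-open (outside ∷ inside  ∷ outside ∷ outside ∷ []) p = open-singleton b p
  trivial-or-singleton-open (outside ∷ outside ∷ inside  ∷ outside ∷ []) p = open-singleton c p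
  trivial-or-singleton-open (outside ∷ outside ∷ outside ∷ inside  ∷ []) p = open-singleton d p
  trivial-or-singleton-open (inside  ∷ inside  ∷ outside ∷ outside ∷ []) p = open-singleton a (shrink-open a p)
  trivial-or-singleton-open (inside  ∷ outside ∷ inside  ∷ outside ∷ []) p = open-singleton a (shrink-open a p)
  trivial-or-singleton-open (inside  ∷ outside ∷ outside ∷ inside  ∷ []) p = open-singleton a (shrink-open a p)
  trivial-or-singleton-open (outside ∷ inside  ∷ inside  ∷ outside ∷ []) p = open-singleton b (shrink-open b p)
  trivial-or-singleton-open (outside ∷ inside  ∷ outside ∷ inside  ∷ []) p = open-singleton b (shrink-open b p)
  trivial-or-singleton-open (outside ∷ outside ∷ inside  ∷ inside  ∷ []) p = open-singleton c (shrink-open c p)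
  trivial-or-singleton-open (inside  ∷ inside  ∷ inside  ∷ outside ∷ []) p =
    open-singleton a (shrink-open a (shrink-open a p))
  trivial-or-singleton-open (inside  ∷ inside  ∷ outside ∷ inside  ∷ []) p =
    open-singleton a (shrink-open a (shrink-open a p))
  trivial-or-singleton-open (inside  ∷ outside ∷ inside  ∷ inside  ∷ []) p =
    open-singleton a (shrink-open a (shrink-open a p))
  trivial-or-singleton-open (outside ∷ inside  ∷ inside  ∷ inside  ∷ []) p =
    open-singleton b (shrink-open b (shrink-open b p))

  discrete-or-indiscrete : Discrete T ⊎ Indiscrete T
  discrete-or-indiscrete with T ⁅ a ⁆ ≟ true
  ... | yes a-open = inj₁ (discrete-if-singletons-open (proj₁ C) (singletons-open-if-a-open a-open))
  ... | no a-closed = inj₂ (indiscrete-if-only-trivial-open (proj₁ C) only-trivial)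
    where
    only-trivial : ∀ S → Open T S → S ≡ ∅ ⊎ S ≡ Full
    only-trivial S S-open with trivial-or-singleton-open S S-open
    ... | inj₁ S≡∅                 = inj₁ S≡∅
    ... | inj₂ (inj₁ S≡Full)       = inj₂ S≡Full
    ... | inj₂ (inj₂ (x , x-open)) = ⊥-elim (a-closed (a-open-if-singleton-open x x-open))

mainTheorem6 : ∀ T → Compatible _◃_ T ⇔ (Discrete T ⊎ Indiscrete T)
mainTheorem6 T = mk⇔ discrete-or-indiscrete λ where
  (inj₁ D) → DiscreteTopology.compatible D ◃-rightInvertible
  (inj₂ I) → IndiscreteTopology.compatible I ◃-rightInvertible
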